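{- Fix integers $c \geq 0$ and $b \geq 2$, and let $S_{[c,b]}:\mathbb{Z}^+\to\mathbb{Z}^+$ be defined by $S_{[c,b]}\left(\sum_{i=0}^n a_i b^i\right) = c + \sum_{i=0}^n a_i^2$, where $\sum_{i=0}^n a_i b^i$ is the base $b$ expansion ($0 \le a_i \le b-1$, $a_n \neq 0$). Let $a = \sum_{i=0}^n a_i b^i \in \mathbb{Z}^+$ in standard base $b$ notation with $a_1 \neq 0$, and let $\tilde{a} = \sum_{i=2}^n a_i b^i + (b-a_1)b + a_0$. Then $a$ is a fixed point of $S_{[c,b]}$ if and only if $\tilde{a}$ is a fixed point of $S_{[c,b]}$.
   Context: A fixed point of $S_{[c,b]}$ is a positive integer $a$ with $S_{[c,b]}(a)=a$. -}

module Defs where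

open import Data.Nat using (ℕ; zero; suc; _+_; _*_; _∸_; _^_; _<_; NonZero)
open import Data.Nat.DivMod using (_/_; _%_)
open import Data.List using (List; []; _∷_; map)
open import Data.Nat.ListAction using (sum)
open import Data.Product using (_×_)
open import Relation.Binary.PropositionalEquality using (_≡_)

-- Base-b digits of n, least significant first (a_0, a_1, ..., a_n with a_n ≠ 0);
-- digits of 0 is the empty list. Fuel n suffices since n / b < n for b ≥ 2.
digitsF : (b : ℕ) → .{{_ : NonZero b}} → ℕ → ℕ → List ℕ
digitsF b zero    n       = []
digitsF b (suc f) zero    = []
digitsF b (suc f) (suc m) = (suc m % b) ∷ digitsF b f (suc m / b)

digits : (b : ℕ) → .{{_ : NonZero b}} → ℕ → List ℕ
digits b n = digitsF b n n

S : (c b : ℕ) → .{{_ : NonZero b}} → ℕ → ℕ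
S c b a = c + sum (map (λ d → d * d) (digits b a))

IsFixedPoint : (c b : ℕ) → .{{_ : NonZero b}} → ℕ → Set
IsFixedPoint c b a = (0 < a) × (S c b a ≡ a)

-- For a = Σ_{i=0}^n a_i b^i (base b), with a_0 = a % b, a_1 = (a / b) % b and
-- Σ_{i=2}^n a_i b^i = (a / b / b) * b²:
--   ã = Σ_{i=2}^n a_i b^i + (b - a_1) b + a_0
tilde : (b : ℕ) → .{{_ : NonZero b}} → ℕ → ℕ
tilde b a = (a / b / b) * (b * b) + (b ∸ (a / b) % b) * b + a % b

{-# OPTIONS --safe #-}
module Submission where

-- Write a = (q b + a₁) b + a₀ and ã = (q b + e) b + a₀ with e = b − a₁. Both
-- share every digit except the second, so S(a) − a and S(ã) − ã differ by
-- (a₁² − a₁ b) − (e² − e b) = (a₁ − e)(a₁ + e − b) = 0. Hence S(a) = a exactly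
-- when S(ã) = ã; positivity of ã comes from its nonzero digit e.

open import Defs
open import Data.Nat using (ℕ; zero; suc; _+_; _*_; _∸_; _≤_; _<_; NonZero; s≤s; z<s)
open import Data.Nat.Properties
open import Data.Nat.DivMod
open import Data.Nat.Divisibility using (divides-refl)
open import Data.List using (map)
open import Data.Nat.ListAction using (sum)
open import Data.Product using (_,_)
open import Function.Bundles using (_⇔_; mk⇔)
open import Relation.Binary.PropositionalEquality
open import Data.Nat.Tactic.RingSolver using (solve-∀)

module _ (b : ℕ) .{{_ : NonZero b}} where

  [m*b+r]/b≡m : ∀ m {r} → r < b → (m * b + r) / b ≡ m
  [m*b+r]/b≡m m {r} r<b = begin
      (m * b + r) / b    ≡⟨ +-distrib-/-∣ˡ r (divides-refl m) ⟩
      m * b / b + r / b  ≡⟨ cong₂ _+_ (m*n/n≡m m b) (m<n⇒m/n≡0 r<b) ⟩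
      m + 0              ≡⟨ +-identityʳ m ⟩
      m                  ∎
    where open ≡-Reasoning

  [m*b+r]%b≡r : ∀ m {r} → r < b → (m * b + r) % b ≡ r
  [m*b+r]%b≡r m {r} r<b = begin
      (m * b + r) % b  ≡⟨ cong (_% b) (+-comm (m * b) r) ⟩
      (r + m * b) % b  ≡⟨ [m+kn]%n≡m%n r m b ⟩
      r % b            ≡⟨ m<n⇒m%n≡m r<b ⟩
      r                ∎
    where open ≡-Reasoning

  m≡[m/b/b*b+m/b%b]*b+m%b : ∀ m → m ≡ (m / b / b * b + m / b % b) * b + m % b
  m≡[m/b/b*b+m/b%b]*b+m%b m = begin
      m                                        ≡⟨ m≡m%n+[m/n]*n m b ⟩
      m % b + m / b * b                        ≡⟨ cong (λ k → m % b + k * b) (m≡m%n+[m/n]*n (m / b) b) ⟩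
      m % b + (m / b % b + m / b / b * b) * b  ≡⟨ cong (λ k → m % b + k * b) (+-comm (m / b % b) _) ⟩
      m % b + (m / b / b * b + m / b % b) * b  ≡⟨ +-comm (m % b) _ ⟩
      (m / b / b * b + m / b % b) * b + m % b  ∎
    where open ≡-Reasoning

  tilde≡[m/b/b*b+[b∸m/b%b]]*b+m%b : ∀ m → tilde b m ≡ (m / b / b * b + (b ∸ m / b % b)) * b + m % b
  tilde≡[m/b/b*b+[b∸m/b%b]]*b+m%b m = reassociate (m / b / b) b (b ∸ m / b % b) (m % b)
    where
    reassociate : ∀ q b e r → q * (b * b) + e * b + r ≡ (q * b + e) * b + r
    reassociate = solve-∀

module DigitSquareSum (b : ℕ) .{{_ : NonZero b}} (1<b : 1 < b) where

  sqSumF : ℕ → ℕ → ℕ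
  sqSumF f n = sum (map (λ d → d * d) (digitsF b f n))

  sqSum : ℕ → ℕ
  sqSum n = sqSumF n n

  [1+n]/b≤n : ∀ n → suc n / b ≤ n
  [1+n]/b≤n n = ≤-pred (m/n<m (suc n) b 1<b)

  sqSumF-fuel-irrelevant : ∀ f g n → n ≤ f → n ≤ g → sqSumF f n ≡ sqSumF g n
  sqSumF-fuel-irrelevant zero    zero    zero _ _ = refl
  sqSumF-fuel-irrelevant zero    (suc _) zero _ _ = refl
  sqSumF-fuel-irrelevant (suc _) zero    zero _ _ = refl
  sqSumF-fuel-irrelevant (suc _) (suc _) zero _ _ = refl
  sqSumF-fuel-irrelevant (suc f) (suc g) (suc n) (s≤s n≤f) (s≤s n≤g) =
    cong (suc n % b * (suc n % b) +_)
      (sqSumF-fuel-irrelevant f g (suc n / b) (≤-trans ([1+n]/b≤n n) n≤f) (≤-trans ([1+n]/b≤n n) n≤g))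

  sqSum-unfold : ∀ n → sqSum n ≡ n % b * (n % b) + sqSum (n / b)
  sqSum-unfold zero    =
    sym (cong₂ (λ x y → x * x + sqSum y) (m<n⇒m%n≡m (<-trans z<s 1<b)) (0/n≡0 b))
  sqSum-unfold (suc n) = cong (suc n % b * (suc n % b) +_)
    (sqSumF-fuel-irrelevant n (suc n / b) (suc n / b) ([1+n]/b≤n n) ≤-refl)

  sqSum-snoc : ∀ m {r} → r < b → sqSum (m * b + r) ≡ r * r + sqSum m
  sqSum-snoc m {r} r<b = begin
      sqSum (m * b + r)
        ≡⟨ sqSum-unfold (m * b + r) ⟩
      (m * b + r) % b * ((m * b + r) % b) + sqSum ((m * b + r) / b)
        ≡⟨ cong₂ (λ x y → x * x + sqSum y) ([m*b+r]%b≡r b m r<b) ([m*b+r]/b≡m b m r<b) ⟩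
      r * r + sqSum m ∎
    where open ≡-Reasoning

  S-twoDigits : ∀ c q {d r} → d < b → r < b →
    S c b ((q * b + d) * b + r) ≡ (c + sqSum q + r * r) + d * d
  S-twoDigits c q {d} {r} d<b r<b = begin
      c + sqSum ((q * b + d) * b + r)  ≡⟨ cong (c +_) (sqSum-snoc (q * b + d) r<b) ⟩
      c + (r * r + sqSum (q * b + d))  ≡⟨ cong (λ k → c + (r * r + k)) (sqSum-snoc q d<b) ⟩
      c + (r * r + (d * d + sqSum q))  ≡⟨ shuffle c (r * r) (d * d) (sqSum q) ⟩
      c + sqSum q + r * r + d * d      ∎
    where
    open ≡-Reasoning
    shuffle : ∀ c x y s → c + (x + (y + s)) ≡ c + s + x + y
    shuffle = solve-∀

-- Truncated subtraction is avoided: the swap identity a₁² − a₁ b = e² − e b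
-- is stated with both sides moved, which makes it a semiring identity.
square-swap : ∀ x e {b} → x + e ≡ b → x * x + e * b ≡ e * e + x * b
square-swap x e refl = identity x e
  where
  identity : ∀ x e → x * x + e * (x + e) ≡ e * e + x * (x + e)
  identity = solve-∀

P+x²≡R+xb⇒P+e²≡R+eb : ∀ P R x e {b} → x + e ≡ b → P + x * x ≡ R + x * b → P + e * e ≡ R + e * b
P+x²≡R+xb⇒P+e²≡R+eb P R x e {b} x+e≡b eq = +-cancelʳ-≡ (x * b) _ _ (begin
    P + e * e + x * b    ≡⟨ +-assoc P _ _ ⟩
    P + (e * e + x * b)  ≡⟨ cong (P +_) (sym (square-swap x e x+e≡b)) ⟩
    P + (x * x + e * b)  ≡⟨ sym (+-assoc P _ _) ⟩
    P + x * x + e * b    ≡⟨ cong (_+ e * b) eq ⟩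
    R + x * b + e * b    ≡⟨ +-assoc R _ _ ⟩
    R + (x * b + e * b)  ≡⟨ cong (R +_) (+-comm (x * b) _) ⟩
    R + (e * b + x * b)  ≡⟨ sym (+-assoc R _ _) ⟩
    R + e * b + x * b    ∎)
  where open ≡-Reasoning

module _ (b : ℕ) .{{_ : NonZero b}} (1<b : 1 < b) where
  open DigitSquareSum b 1<b

  0<[q*b+d]*b+r : ∀ q {d} r → 0 < d → 0 < (q * b + d) * b + r
  0<[q*b+d]*b+r q {d} r 0<d =
    ≤-trans 0<d (≤-trans (m≤n+m d (q * b)) (≤-trans (m≤m*n _ b) (m≤m+n _ r)))

  isFixedPoint-swapMiddleDigit : ∀ c q x e {r} → x + e ≡ b → x < b → e < b → r < b → 0 < e →
    IsFixedPoint c b ((q * b + x) * b + r) → IsFixedPoint c b ((q * b + e) * b + r)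
  isFixedPoint-swapMiddleDigit c q x e {r} x+e≡b x<b e<b r<b 0<e (_ , fixed) =
    0<[q*b+d]*b+r q r 0<e ,
    (begin
      S c b ((q * b + e) * b + r)    ≡⟨ S-twoDigits c q e<b r<b ⟩
      c + sqSum q + r * r + e * e    ≡⟨ P+x²≡R+xb⇒P+e²≡R+eb _ _ x e x+e≡b fixed′ ⟩
      q * b * b + r + e * b          ≡⟨ expand e ⟨
      (q * b + e) * b + r            ∎)
    where
    open ≡-Reasoning
    expand : ∀ d → (q * b + d) * b + r ≡ q * b * b + r + d * b
    expand d = identity q b d r
      where
      identity : ∀ q b d r → (q * b + d) * b + r ≡ q * b * b + r + d * b
      identity = solve-∀
    fixed′ : c + sqSum q + r * r + x * x ≡ q * b * b + r + x * b
    fixed′ = trans (sym (S-twoDigits c q x<b r<b)) (trans fixed (expand x))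

lemma2p2 : (c b : ℕ) .{{_ : NonZero b}} → 2 ≤ b → (a : ℕ) → 0 < a →
    (a / b) % b ≢ 0 →
    (IsFixedPoint c b a ⇔ IsFixedPoint c b (tilde b a))
lemma2p2 c b 2≤b a _ a₁≢0 = mk⇔
  (λ fp → subst (IsFixedPoint c b) (sym ã≡)
    (isFixedPoint-swapMiddleDigit b 2≤b c q a₁ e a₁+e≡b a₁<b e<b a₀<b 0<e
      (subst (IsFixedPoint c b) a≡ fp)))
  (λ fp → subst (IsFixedPoint c b) (sym a≡)
    (isFixedPoint-swapMiddleDigit b 2≤b c q e a₁ (trans (+-comm e a₁) a₁+e≡b) e<b a₁<b a₀<b 0<a₁
      (subst (IsFixedPoint c b) ã≡ fp)))
  where
  q  = a / b / b
  a₁ = a / b % b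
  a₀ = a % b
  e  = b ∸ a₁
  a₁<b = m%n<n (a / b) b
  a₀<b = m%n<n a b
  0<a₁ = n≢0⇒n>0 a₁≢0
  0<e  = m<n⇒0<n∸m a₁<b
  e<b  = ∸-monoʳ-< 0<a₁ (<⇒≤ a₁<b)
  a₁+e≡b = m+[n∸m]≡n (<⇒≤ a₁<b)
  a≡ = m≡[m/b/b*b+m/b%b]*b+m%b b a
  ã≡ = tilde≡[m/b/b*b+[b∸m/b%b]]*b+m%b b a
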